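{- If $\Phi_f=(G,F^\times,\varphi,f)$ is a skew gain graph where $G$ is a tree of order $n$, then $\det L_g(\Phi_f)=0$.
   Context: $F$ is a field of characteristic zero with algebraic closure $\overline F$; $f:F^\times\to F^\times$ is an involutive automorphism and $g(x)=xf(x)$ (so $g(\varphi(\overrightarrow{e}))$ does not depend on the orientation of $e$). $G$ is a finite simple graph with vertices $v_1,\dots,v_n$ and edges with fixed orientations; a skew gain graph $\Phi_f$ assigns gains $\varphi(\overrightarrow{uv})\in F^\times$ with $\varphi(\overrightarrow{vu})=f(\varphi(\overrightarrow{uv}))$. $A(\Phi_f)=(a_{ij})$ with $a_{ij}=\varphi(\overrightarrow{v_iv_j})$ if $v_i\sim v_j$, else $0$. For each edge $e$ fix a square root $\sqrt{g(\varphi(\overrightarrow{e}))}\in\overline F$. $D_g(\Phi_f)=\mathrm{diag}\big(\sum_{e\ni v_i}\sqrt{g(\varphi(\overrightarrow{e}))}\big)$ and $L_g(\Phi_f)=D_g(\Phi_f)-A(\Phi_f)$. -}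

module Defs where

open import Level using (Level; _⊔_) renaming (suc to lsuc)
open import Algebra.Bundles using (CommutativeRing)
open import Data.Nat using (ℕ; zero; suc)
open import Data.Fin using (Fin; zero; suc; toℕ; punchIn; inject₁; fromℕ; _≟_)
open import Data.Bool using (if_then_else_)
open import Data.Product using (Σ; ∃; _×_; _,_)
open import Relation.Nullary using (¬_; Dec; yes; no)
open import Relation.Nullary.Decidable using (⌊_⌋)
open import Relation.Binary.PropositionalEquality using (_≡_)
open import Function.Definitions using (Injective)

module RingNotions {c ℓ : Level} (R : CommutativeRing c ℓ) where
  open CommutativeRing R hiding (zero; sym)

  IsField : Set (c ⊔ ℓ)
  IsField = (¬ (1# ≈ 0#)) × (∀ x → ¬ (x ≈ 0#) → ∃ λ y → x * y ≈ 1#)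

  natR : ℕ → Carrier
  natR zero = 0#
  natR (suc k) = 1# + natR k

  CharZero : Set ℓ
  CharZero = ∀ k → natR k ≈ 0# → k ≡ 0

  Σ[_] : (k : ℕ) → (Fin k → Carrier) → Carrier
  Σ[ zero ] h = 0#
  Σ[ suc k ] h = h zero + Σ[ k ] (λ i → h (suc i))

  pow : Carrier → ℕ → Carrier
  pow x zero = 1#
  pow x (suc k) = x * pow x k

  AlgClosed : Set (c ⊔ ℓ)
  AlgClosed = ∀ k (a : Fin (suc k) → Carrier) →
    ∃ λ x → pow x (suc k) + Σ[ suc k ] (λ i → a i * pow x (toℕ i)) ≈ 0#

  sgn : ℕ → Carrier
  sgn zero = 1#
  sgn (suc k) = - sgn k

  det : (k : ℕ) → (Fin k → Fin k → Carrier) → Carrier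
  det zero M = 1#
  det (suc k) M =
    Σ[ suc k ] (λ j → sgn (toℕ j) * (M zero j * det k (λ a b → M (suc a) (punchIn j b))))

record RingHom {c ℓ c' ℓ' : Level} (R : CommutativeRing c ℓ) (S : CommutativeRing c' ℓ')
       : Set (c ⊔ ℓ ⊔ c' ⊔ ℓ') where
  private
    module R = CommutativeRing R
    module S = CommutativeRing S
  field
    map   : R.Carrier → S.Carrier
    cong  : ∀ {x y} → x R.≈ y → map x S.≈ map y
    map-+ : ∀ x y → map (x R.+ y) S.≈ map x S.+ map y
    map-* : ∀ x y → map (x R.* y) S.≈ map x S.* map y
    map-1 : map R.1# S.≈ S.1#

record SimpleGraph (n : ℕ) : Set₁ where
  field
    Adj    : Fin n → Fin n → Set
    adj?   : ∀ i j → Dec (Adj i j)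
    sym    : ∀ {i j} → Adj i j → Adj j i
    irrefl : ∀ {i} → ¬ Adj i i

module GraphNotions {n : ℕ} (G : SimpleGraph n) where
  open SimpleGraph G

  data Walk : Fin n → Fin n → Set where
    []  : ∀ {u} → Walk u u
    _∷_ : ∀ {u v w} → Adj u v → Walk v w → Walk u w

  Connected : Set
  Connected = ∀ u v → Walk u v

  -- a cycle: k+3 pairwise distinct vertices c₀,…,c_{k+2} with cᵢ ~ cᵢ₊₁ and c_{k+2} ~ c₀
  record Cycle : Set where
    field
      len   : ℕ
      vtx   : Fin (suc (suc (suc len))) → Fin n
      inj   : Injective _≡_ _≡_ vtx
      step  : ∀ (i : Fin (suc (suc len))) → Adj (vtx (inject₁ i)) (vtx (suc i))
      close : Adj (vtx (fromℕ (suc (suc len)))) (vtx zero)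

  Acyclic : Set
  Acyclic = ¬ Cycle

  IsTree : Set
  IsTree = Fin n × Connected × Acyclic

-- The g-Laplacian L_g(Φ_f) = D_g(Φ_f) - A(Φ_f), with entries in K (= F̄)
-- A: entries ι(φ(v_i v_j)) for adjacent vertices, 0 otherwise.
-- D: diagonal, i-th entry Σ_{e ∋ v_i} √g(φ(e)) = Σ_{j ~ i} s i j.

module Laplacian {c ℓ c' ℓ' : Level} {F : CommutativeRing c ℓ} {K : CommutativeRing c' ℓ'}
                 (ι : RingHom F K) {n : ℕ} (G : SimpleGraph n)
                 (φ : Fin n → Fin n → CommutativeRing.Carrier F)
                 (s : Fin n → Fin n → CommutativeRing.Carrier K) where
  open CommutativeRing K hiding (zero; sym)
  open RingNotions K using (Σ[_])
  open SimpleGraph G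

  adjMatrix : Fin n → Fin n → Carrier
  adjMatrix i j = if ⌊ adj? i j ⌋ then RingHom.map ι (φ i j) else 0#

  degMatrix : Fin n → Fin n → Carrier
  degMatrix i j = if ⌊ i ≟ j ⌋
                  then Σ[ n ] (λ k → if ⌊ adj? i k ⌋ then s i k else 0#)
                  else 0#

  Lg : Fin n → Fin n → Carrier
  Lg i j = degMatrix i j - adjMatrix i j

-- Give each oriented edge u → v the gain φ(v,u)/s(v,u). Skew symmetry of φ, symmetry of s
-- and s(u,v)² = φ(u,v) f(φ(u,v)) make the gains of u → v and v → u mutually inverse. In a
-- tree a closed walk can be retraced (stepping back cancels, any other return would close a
-- cycle), so it has gain 1, and x(v) := gain of a walk from a fixed root to v is well defined.
-- Then x(r) s(r,j) = x(j) φ(r,j) on every edge, which says L_g x = 0; since x consists of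
-- units, L_g is singular.
module Submission where

open import Defs
open import Level using (Level)
open import Algebra.Bundles using (CommutativeRing; Monoid)
open import Data.Nat as ℕ using (ℕ; zero; suc)
import Data.Nat.Properties as ℕ
open import Data.Bool using (if_then_else_)
open import Data.Fin using (Fin; zero; suc; toℕ; punchIn; punchOut; inject₁; inject≤; fromℕ; _≟_; _≤_)
open import Data.Fin.Properties
  using (suc-injective; toℕ-injective; toℕ-inject≤; toℕ-fromℕ; toℕ-inject₁; toℕ<n;
         inject≤-injective; punchIn-injective; punchInᵢ≢i; punchIn-punchOut; any?;
         _≤?_; ≤-refl; ≤∧≢⇒<; <⇒≤pred; ≤̄⇒inject₁<; i≤inject₁[j]⇒i≤1+j)
open import Data.Fin.Induction using (<-weakInduction)
open import Data.Vec.Functional using (updateAt)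
open import Data.Vec.Functional.Properties using (updateAt-updates; updateAt-minimal)
open import Data.Product using (∃; _×_; _,_; proj₁; proj₂)
open import Data.Sum using (_⊎_; inj₁; inj₂)
open import Data.Empty using (⊥-elim)
open import Function using (_∘_)
open import Function.Definitions using (Injective)
open import Relation.Nullary using (¬_; Dec; yes; no)
open import Relation.Nullary.Decidable using (⌊_⌋)
open import Relation.Binary.PropositionalEquality as ≡ using (_≡_; _≢_)

punchIn-adjacent-swap : ∀ {m} (i b : Fin m) →
  punchIn (inject₁ i) b ≡ punchIn (suc i) b ⊎
  (punchIn (inject₁ i) b ≡ suc i × punchIn (suc i) b ≡ inject₁ i)
punchIn-adjacent-swap zero    zero    = inj₂ (≡.refl , ≡.refl)
punchIn-adjacent-swap zero    (suc b) = inj₁ ≡.refl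
punchIn-adjacent-swap (suc i) zero    = inj₁ ≡.refl
punchIn-adjacent-swap (suc i) (suc b) with punchIn-adjacent-swap i b
... | inj₁ eq          = inj₁ (≡.cong suc eq)
... | inj₂ (eq₁ , eq₂) = inj₂ (≡.cong suc eq₁ , ≡.cong suc eq₂)

punchIn-adjacent : ∀ {m} (i : Fin (suc m)) (j : Fin (suc (suc m))) →
  j ≢ inject₁ i → j ≢ suc i →
  ∃ λ i′ → punchIn j (inject₁ i′) ≡ inject₁ i × punchIn j (suc i′) ≡ suc i
punchIn-adjacent zero zero j≢i _ = ⊥-elim (j≢i ≡.refl)
punchIn-adjacent zero (suc zero) _ j≢1+i = ⊥-elim (j≢1+i ≡.refl)
punchIn-adjacent {suc m} zero (suc (suc j)) _ _ = zero , ≡.refl , ≡.refl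
punchIn-adjacent {suc m} (suc i) zero _ _ = i , ≡.refl , ≡.refl
punchIn-adjacent {suc m} (suc i) (suc j) j≢i j≢1+i
  with punchIn-adjacent i j (j≢i ∘ ≡.cong suc) (j≢1+i ∘ ≡.cong suc)
... | i′ , eq₁ , eq₂ = suc i′ , ≡.cong suc eq₁ , ≡.cong suc eq₂

inject₁≢suc : ∀ {m} (i : Fin m) → inject₁ i ≢ suc i
inject₁≢suc zero    ()
inject₁≢suc (suc i) eq = inject₁≢suc i (suc-injective eq)

inject₁-inject≤ : ∀ {m n} (i : Fin m) .(m≤n : m ℕ.≤ n) →
  inject₁ (inject≤ i m≤n) ≡ inject≤ (inject₁ i) (ℕ.s≤s m≤n)
inject₁-inject≤ {n = suc _} zero    _   = ≡.refl
inject₁-inject≤ {n = suc _} (suc i) m≤n = ≡.cong suc (inject₁-inject≤ i (ℕ.s≤s⁻¹ m≤n))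

module Units {c ℓ : Level} (R : CommutativeRing c ℓ) where
  open CommutativeRing R hiding (zero)
  open import Algebra.Definitions _≈_ using (RightInvertible)
  open import Relation.Binary.Reasoning.Setoid setoid

  Unit : Carrier → Set (c Level.⊔ ℓ)
  Unit = RightInvertible 1# _*_

  NonZeroDivisor : Carrier → Set (c Level.⊔ ℓ)
  NonZeroDivisor a = ∀ {y} → a * y ≈ 0# → y ≈ 0#

  unit⇒nonZeroDivisor : ∀ {a} → Unit a → NonZeroDivisor a
  unit⇒nonZeroDivisor {a} (a⁻¹ , aa⁻¹≈1) {y} ay≈0 = begin
    y              ≈⟨ *-identityˡ y ⟨
    1# * y         ≈⟨ *-congʳ (trans (*-comm a⁻¹ a) aa⁻¹≈1) ⟨
    (a⁻¹ * a) * y  ≈⟨ *-assoc a⁻¹ a y ⟩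
    a⁻¹ * (a * y)  ≈⟨ *-congˡ ay≈0 ⟩
    a⁻¹ * 0#       ≈⟨ zeroʳ a⁻¹ ⟩
    0#             ∎

  unit-* : ∀ {a b} → Unit a → Unit b → Unit (a * b)
  unit-* {a} {b} (a⁻¹ , aa⁻¹≈1) (b⁻¹ , bb⁻¹≈1) = b⁻¹ * a⁻¹ , (begin
    (a * b) * (b⁻¹ * a⁻¹)  ≈⟨ *-assoc a b _ ⟩
    a * (b * (b⁻¹ * a⁻¹))  ≈⟨ *-congˡ (*-assoc b b⁻¹ a⁻¹) ⟨
    a * ((b * b⁻¹) * a⁻¹)  ≈⟨ *-congˡ (trans (*-congʳ bb⁻¹≈1) (*-identityˡ a⁻¹)) ⟩
    a * a⁻¹                ≈⟨ aa⁻¹≈1 ⟩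
    1#                     ∎)

  unit-respects-≈ : ∀ {a b} → a ≈ b → Unit a → Unit b
  unit-respects-≈ a≈b (a⁻¹ , aa⁻¹≈1) = a⁻¹ , trans (*-congʳ (sym a≈b)) aa⁻¹≈1

  unit-*ˡ : ∀ {a b} → Unit (a * b) → Unit a
  unit-*ˡ {a} {b} (u , abu≈1) = b * u , trans (sym (*-assoc a b u)) abu≈1

RingHom-unit : ∀ {c ℓ c′ ℓ′} {R : CommutativeRing c ℓ} {S : CommutativeRing c′ ℓ′}
  (ι : RingHom R S) {a : CommutativeRing.Carrier R} →
  Units.Unit R a → Units.Unit S (RingHom.map ι a)
RingHom-unit {S = S} ι (a⁻¹ , aa⁻¹≈1) =
  map a⁻¹ , S.trans (S.sym (map-* _ a⁻¹)) (S.trans (cong aa⁻¹≈1) map-1)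
  where
  module S = CommutativeRing S
  open RingHom ι

module Determinant {ℓ₁ ℓ₂ : Level} (R : CommutativeRing ℓ₁ ℓ₂) where
  open CommutativeRing R hiding (zero)
  open RingNotions R using (Σ[_]; sgn; det)
  open Units R using (NonZeroDivisor)
  open import Algebra.Properties.Semiring.Sum semiring
    using (sum; sum-cong-≋; ∑-distrib-+; *-distribˡ-sum; sum-remove; sum-replicate-zero)
  open import Algebra.Properties.Ring ring using (-‿distribˡ-*)
  open import Algebra.Solver.Ring.NaturalCoefficients.Default commutativeSemiring
    using (solve; _:=_; _:+_; _:*_)
  open import Relation.Binary.Reasoning.Setoid setoid

  Σ≡sum : ∀ k (h : Fin k → Carrier) → Σ[ k ] h ≡ sum h
  Σ≡sum zero    h = ≡.refl
  Σ≡sum (suc k) h = ≡.cong (h zero +_) (Σ≡sum k (h ∘ suc))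

  sum-zero : ∀ {k} {h : Fin k → Carrier} → (∀ i → h i ≈ 0#) → sum h ≈ 0#
  sum-zero {k} h≈0 = trans (sum-cong-≋ h≈0) (sum-replicate-zero k)

  sum-linear : ∀ {k} a b (f g : Fin k → Carrier) →
    sum (λ i → a * f i + b * g i) ≈ a * sum f + b * sum g
  sum-linear a b f g = begin
    sum (λ i → a * f i + b * g i)              ≈⟨ ∑-distrib-+ (λ i → a * f i) (λ i → b * g i) ⟩
    sum (λ i → a * f i) + sum (λ i → b * g i)  ≈⟨ +-cong (*-distribˡ-sum a f) (*-distribˡ-sum b g) ⟨
    a * sum f + b * sum g                      ∎

  sum-single : ∀ {k} (h : Fin k → Carrier) p → (∀ i → i ≢ p → h i ≈ 0#) → sum h ≈ h p
  sum-single {suc k} h p h≈0 = begin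
    sum h                      ≈⟨ sum-remove {i = p} h ⟩
    h p + sum (h ∘ punchIn p)  ≈⟨ +-congˡ (sum-zero (λ j → h≈0 (punchIn p j) (punchInᵢ≢i p j))) ⟩
    h p + 0#                   ≈⟨ +-identityʳ (h p) ⟩
    h p                        ∎

  sum-adjacentPair : ∀ {k} (t : Fin (suc k) → Carrier) (i : Fin k) →
    (∀ j → j ≢ inject₁ i → j ≢ suc i → t j ≈ 0#) → t (inject₁ i) + t (suc i) ≈ 0# →
    sum t ≈ 0#
  sum-adjacentPair {suc k} t zero t≈0 pair≈0 = begin
    t zero + (t (suc zero) + sum (λ j → t (suc (suc j))))  ≈⟨ +-assoc _ _ _ ⟨
    (t zero + t (suc zero)) + sum (λ j → t (suc (suc j)))  ≈⟨ +-cong pair≈0 rest≈0 ⟩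
    0# + 0#                                                ≈⟨ +-identityʳ 0# ⟩
    0#                                                     ∎
    where
    rest≈0 : sum (λ j → t (suc (suc j))) ≈ 0#
    rest≈0 = sum-zero (λ j → t≈0 (suc (suc j)) (λ ()) (λ ()))
  sum-adjacentPair {suc k} t (suc i) t≈0 pair≈0 = begin
    t zero + sum (t ∘ suc)  ≈⟨ +-cong (t≈0 zero (λ ()) (λ ())) tail≈0 ⟩
    0# + 0#                 ≈⟨ +-identityʳ 0# ⟩
    0#                      ∎
    where
    tail≈0 : sum (t ∘ suc) ≈ 0#
    tail≈0 = sum-adjacentPair (t ∘ suc) i
      (λ j j≢i j≢1+i → t≈0 (suc j) (j≢i ∘ suc-injective) (j≢1+i ∘ suc-injective)) pair≈0

  Matrix : ℕ → Set ℓ₁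
  Matrix k = Fin k → Fin k → Carrier

  minor : ∀ {k} → Matrix (suc k) → Fin (suc k) → Matrix k
  minor M j a b = M (suc a) (punchIn j b)

  cofactorTerm : ∀ {k} → Matrix (suc k) → Fin (suc k) → Carrier
  cofactorTerm {k} M j = sgn (toℕ j) * (M zero j * det k (minor M j))

  det-expand : ∀ {k} (M : Matrix (suc k)) → det (suc k) M ≡ sum (cofactorTerm M)
  det-expand {k} M = Σ≡sum (suc k) (cofactorTerm M)

  cofactorTerm-minor≈0 : ∀ {k} (M : Matrix (suc k)) j → det k (minor M j) ≈ 0# →
    cofactorTerm M j ≈ 0#
  cofactorTerm-minor≈0 M j minor≈0 =
    trans (*-congˡ (trans (*-congˡ minor≈0) (zeroʳ _))) (zeroʳ _)

  det-cong : ∀ {k} {M N : Matrix k} → (∀ a b → M a b ≈ N a b) → det k M ≈ det k N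
  det-cong {zero}          M≈N = refl
  det-cong {suc k} {M} {N} M≈N = begin
    det (suc k) M         ≡⟨ det-expand M ⟩
    sum (cofactorTerm M)  ≈⟨ sum-cong-≋ term≈ ⟩
    sum (cofactorTerm N)  ≡⟨ det-expand N ⟨
    det (suc k) N         ∎
    where
    term≈ : ∀ j → cofactorTerm M j ≈ cofactorTerm N j
    term≈ j = *-congˡ (*-cong (M≈N zero j) (det-cong (λ a b → M≈N (suc a) (punchIn j b))))

  det-zeroColumn : ∀ {k} (M : Matrix k) q → (∀ r → M r q ≈ 0#) → det k M ≈ 0#
  det-zeroColumn {suc k} M q M·q≈0 = begin
    det (suc k) M         ≡⟨ det-expand M ⟩
    sum (cofactorTerm M)  ≈⟨ sum-zero term≈0 ⟩
    0#                    ∎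
    where
    term≈0 : ∀ j → cofactorTerm M j ≈ 0#
    term≈0 j with j ≟ q
    ... | yes ≡.refl = trans (*-congˡ (trans (*-congʳ (M·q≈0 zero)) (zeroˡ _))) (zeroʳ _)
    ... | no j≢q = cofactorTerm-minor≈0 M j (det-zeroColumn (minor M j) (punchOut j≢q)
          (λ r → trans (reflexive (≡.cong (M (suc r)) (punchIn-punchOut j≢q))) (M·q≈0 (suc r))))

  private
    distrib-entry : ∀ s a b x y d →
      s * ((a * x + b * y) * d) ≈ a * (s * (x * d)) + b * (s * (y * d))
    distrib-entry = solve 6 (λ s a b x y d →
      s :* ((a :* x :+ b :* y) :* d) := a :* (s :* (x :* d)) :+ b :* (s :* (y :* d))) refl

    distrib-minor : ∀ s a b x d e →
      s * (x * (a * d + b * e)) ≈ a * (s * (x * d)) + b * (s * (x * e))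
    distrib-minor = solve 6 (λ s a b x d e →
      s :* (x :* (a :* d :+ b :* e)) := a :* (s :* (x :* d)) :+ b :* (s :* (x :* e))) refl

  det-linearColumn : ∀ {k} (A B C : Matrix k) q a b →
    (∀ r j → j ≢ q → C r j ≈ A r j) → (∀ r j → j ≢ q → C r j ≈ B r j) →
    (∀ r → C r q ≈ a * A r q + b * B r q) → det k C ≈ a * det k A + b * det k B
  det-linearColumn {suc k} A B C q a b C≈A C≈B C·q = begin
    det (suc k) C
      ≡⟨ det-expand C ⟩
    sum (cofactorTerm C)
      ≈⟨ sum-cong-≋ term ⟩
    sum (λ j → a * cofactorTerm A j + b * cofactorTerm B j)
      ≈⟨ sum-linear a b (cofactorTerm A) (cofactorTerm B) ⟩
    a * sum (cofactorTerm A) + b * sum (cofactorTerm B)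
      ≡⟨ ≡.cong₂ (λ u v → a * u + b * v) (det-expand A) (det-expand B) ⟨
    a * det (suc k) A + b * det (suc k) B ∎
    where
    term : ∀ j → cofactorTerm C j ≈ a * cofactorTerm A j + b * cofactorTerm B j
    term j with j ≟ q
    ... | yes ≡.refl = begin
      s * (C zero j * det k (minor C j))
        ≈⟨ *-congˡ (*-congʳ (C·q zero)) ⟩
      s * ((a * A zero j + b * B zero j) * det k (minor C j))
        ≈⟨ distrib-entry s a b _ _ _ ⟩
      a * (s * (A zero j * det k (minor C j))) + b * (s * (B zero j * det k (minor C j)))
        ≈⟨ +-cong (*-congˡ (*-congˡ (*-congˡ (det-cong (sameMinor C≈A)))))
                  (*-congˡ (*-congˡ (*-congˡ (det-cong (sameMinor C≈B))))) ⟩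
      a * cofactorTerm A j + b * cofactorTerm B j ∎
      where
      s = sgn (toℕ j)
      sameMinor : ∀ {X} → (∀ r i → i ≢ j → C r i ≈ X r i) → ∀ r i → minor C j r i ≈ minor X j r i
      sameMinor C≈X r i = C≈X (suc r) (punchIn j i) (punchInᵢ≢i j i)
    ... | no j≢q = begin
      s * (C zero j * det k (minor C j))
        ≈⟨ *-congˡ (*-congˡ minor-linear) ⟩
      s * (C zero j * (a * det k (minor A j) + b * det k (minor B j)))
        ≈⟨ distrib-minor s a b _ _ _ ⟩
      a * (s * (C zero j * det k (minor A j))) + b * (s * (C zero j * det k (minor B j)))
        ≈⟨ +-cong (*-congˡ (*-congˡ (*-congʳ (C≈A zero j j≢q))))
                  (*-congˡ (*-congˡ (*-congʳ (C≈B zero j j≢q)))) ⟩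
      a * cofactorTerm A j + b * cofactorTerm B j ∎
      where
      s = sgn (toℕ j)
      q′ = punchOut j≢q
      punchIn≢q : ∀ i → i ≢ q′ → punchIn j i ≢ q
      punchIn≢q i i≢q′ eq =
        i≢q′ (punchIn-injective j i q′ (≡.trans eq (≡.sym (punchIn-punchOut j≢q))))
      minor-linear : det k (minor C j) ≈ a * det k (minor A j) + b * det k (minor B j)
      minor-linear = det-linearColumn (minor A j) (minor B j) (minor C j) q′ a b
        (λ r i i≢q′ → C≈A (suc r) (punchIn j i) (punchIn≢q i i≢q′))
        (λ r i i≢q′ → C≈B (suc r) (punchIn j i) (punchIn≢q i i≢q′))
        (λ r → ≡.subst (λ i → C (suc r) i ≈ a * A (suc r) i + b * B (suc r) i)
                       (≡.sym (punchIn-punchOut j≢q)) (C·q (suc r)))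

  det-adjacentEqualColumns : ∀ {k} (M : Matrix (suc k)) (i : Fin k) →
    (∀ r → M r (inject₁ i) ≈ M r (suc i)) → det (suc k) M ≈ 0#
  det-adjacentEqualColumns {suc k} M i M·i≈M·i+1 = begin
    det (suc (suc k)) M   ≡⟨ det-expand M ⟩
    sum (cofactorTerm M)  ≈⟨ sum-adjacentPair (cofactorTerm M) i term≈0 pair≈0 ⟩
    0#                    ∎
    where
    entries≈ : ∀ {r u v} → u ≡ inject₁ i → v ≡ suc i → M r u ≈ M r v
    entries≈ ≡.refl ≡.refl = M·i≈M·i+1 _

    term≈0 : ∀ j → j ≢ inject₁ i → j ≢ suc i → cofactorTerm M j ≈ 0#
    term≈0 j j≢i j≢1+i with punchIn-adjacent i j j≢i j≢1+i
    ... | i′ , eq₁ , eq₂ = cofactorTerm-minor≈0 M j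
          (det-adjacentEqualColumns (minor M j) i′ (λ r → entries≈ eq₁ eq₂))

    minors≈ : ∀ a b → minor M (inject₁ i) a b ≈ minor M (suc i) a b
    minors≈ a b with punchIn-adjacent-swap i b
    ... | inj₁ eq          = reflexive (≡.cong (M (suc a)) eq)
    ... | inj₂ (eq₁ , eq₂) = sym (entries≈ eq₂ eq₁)

    s = sgn (toℕ (inject₁ i))

    pair≈0 : cofactorTerm M (inject₁ i) + cofactorTerm M (suc i) ≈ 0#
    pair≈0 = begin
      cofactorTerm M (inject₁ i) + cofactorTerm M (suc i)
        ≈⟨ +-congˡ (*-cong (reflexive (≡.cong (-_ ∘ sgn) (≡.sym (toℕ-inject₁ i))))
                           (*-cong (sym (M·i≈M·i+1 zero)) (sym (det-cong minors≈)))) ⟩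
      cofactorTerm M (inject₁ i) + - s * (M zero (inject₁ i) * det (suc k) (minor M (inject₁ i)))
        ≈⟨ +-congˡ (-‿distribˡ-* _ _) ⟨
      cofactorTerm M (inject₁ i) + - cofactorTerm M (inject₁ i)
        ≈⟨ -‿inverseʳ _ ⟩
      0# ∎

  det-scaleColumn : ∀ {k} (A C : Matrix k) q y →
    (∀ r j → j ≢ q → C r j ≈ A r j) → (∀ r → C r q ≈ y * A r q) → det k C ≈ y * det k A
  det-scaleColumn {k} A C q y C≈A C·q = begin
    det k C                     ≈⟨ det-linearColumn A A C q 0# y C≈A C≈A C·q′ ⟩
    0# * det k A + y * det k A  ≈⟨ +-congʳ (zeroˡ _) ⟩
    0# + y * det k A            ≈⟨ +-identityˡ _ ⟩
    y * det k A                 ∎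
    where
    C·q′ : ∀ r → C r q ≈ 0# * A r q + y * A r q
    C·q′ r = trans (C·q r) (sym (trans (+-congʳ (zeroˡ _)) (+-identityˡ _)))

  det-addAdjacentColumn : ∀ {k} (A C : Matrix (suc k)) (i : Fin k) y →
    (∀ r j → j ≢ suc i → C r j ≈ A r j) →
    (∀ r → C r (suc i) ≈ A r (inject₁ i) + y * A r (suc i)) →
    det (suc k) C ≈ y * det (suc k) A
  det-addAdjacentColumn {k} A C i y C≈A C·i+1 = begin
    det (suc k) C                            ≈⟨ det-linearColumn A′ A C (suc i) 1# y C≈A′ C≈A C·i+1′ ⟩
    1# * det (suc k) A′ + y * det (suc k) A  ≈⟨ +-congʳ (trans (*-congˡ detA′≈0) (zeroʳ 1#)) ⟩
    0# + y * det (suc k) A                   ≈⟨ +-identityˡ _ ⟩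
    y * det (suc k) A                        ∎
    where
    A′ : Matrix (suc k)
    A′ r = updateAt (A r) (suc i) (λ _ → A r (inject₁ i))
    A′-updated : ∀ r → A′ r (suc i) ≡ A r (inject₁ i)
    A′-updated r = updateAt-updates (suc i) (A r)
    A′-unchanged : ∀ r j → j ≢ suc i → A′ r j ≡ A r j
    A′-unchanged r j j≢i+1 = updateAt-minimal j (suc i) (A r) j≢i+1
    detA′≈0 : det (suc k) A′ ≈ 0#
    detA′≈0 = det-adjacentEqualColumns A′ i λ r →
      reflexive (≡.trans (A′-unchanged r (inject₁ i) (inject₁≢suc i)) (≡.sym (A′-updated r)))
    C≈A′ : ∀ r j → j ≢ suc i → C r j ≈ A′ r j
    C≈A′ r j j≢i+1 = trans (C≈A r j j≢i+1) (reflexive (≡.sym (A′-unchanged r j j≢i+1)))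
    C·i+1′ : ∀ r → C r (suc i) ≈ 1# * A′ r (suc i) + y * A r (suc i)
    C·i+1′ r = trans (C·i+1 r)
      (+-congʳ (trans (reflexive (≡.sym (A′-updated r))) (sym (*-identityˡ _))))

  partialSum : ∀ {k} → (Fin (suc k) → Carrier) → Fin (suc k) → Carrier
  partialSum         h zero    = h zero
  partialSum {suc k} h (suc c) = h zero + partialSum (h ∘ suc) c

  partialSum-suc : ∀ {k} (h : Fin (suc k) → Carrier) (i : Fin k) →
    partialSum h (suc i) ≈ partialSum h (inject₁ i) + h (suc i)
  partialSum-suc {suc k} h zero    = refl
  partialSum-suc {suc k} h (suc i) =
    trans (+-congˡ (partialSum-suc (h ∘ suc) i)) (sym (+-assoc _ _ _))

  partialSum-fromℕ : ∀ k (h : Fin (suc k) → Carrier) → partialSum h (fromℕ k) ≈ sum h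
  partialSum-fromℕ zero    h = sym (+-identityʳ _)
  partialSum-fromℕ (suc k) h = +-congˡ (partialSum-fromℕ k (h ∘ suc))

  -- Passing from c to c + 1 is the column operation M·c₊₁ ↦ (column c) + x_{c+1} M·c₊₁, so
  -- det (prefixSumColumns M x c) = x₀ ⋯ x_c det M; for the last c the last column is M x.
  prefixSumColumns : ∀ {k} → Matrix (suc k) → (Fin (suc k) → Carrier) → Fin (suc k) → Matrix (suc k)
  prefixSumColumns M x c r j =
    if ⌊ j ≤? c ⌋ then partialSum (λ i → x i * M r i) j else M r j

  module _ {k} (M : Matrix (suc k)) (x : Fin (suc k) → Carrier) where

    private
      Q = prefixSumColumns M x

    prefixSumColumns-≤ : ∀ {c j} r → j ≤ c → Q c r j ≡ partialSum (λ i → x i * M r i) j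
    prefixSumColumns-≤ {c} {j} r j≤c with j ≤? c
    ... | yes _  = ≡.refl
    ... | no j≰c = ⊥-elim (j≰c j≤c)

    prefixSumColumns-≰ : ∀ {c j} r → ¬ j ≤ c → Q c r j ≡ M r j
    prefixSumColumns-≰ {c} {j} r j≰c with j ≤? c
    ... | yes j≤c = ⊥-elim (j≰c j≤c)
    ... | no _    = ≡.refl

    det-prefixSumColumns-zero : det (suc k) (Q zero) ≈ x zero * det (suc k) M
    det-prefixSumColumns-zero = det-scaleColumn M (Q zero) zero (x zero) off
      (λ r → reflexive (prefixSumColumns-≤ {zero} r ℕ.z≤n))
      where
      off : ∀ r j → j ≢ zero → Q zero r j ≈ M r j
      off r zero    j≢0 = ⊥-elim (j≢0 ≡.refl)
      off r (suc j) _   = reflexive (prefixSumColumns-≰ {zero} r λ ())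

    det-prefixSumColumns-suc : ∀ i →
      det (suc k) (Q (suc i)) ≈ x (suc i) * det (suc k) (Q (inject₁ i))
    det-prefixSumColumns-suc i =
      det-addAdjacentColumn (Q (inject₁ i)) (Q (suc i)) i (x (suc i)) off column
      where
      off : ∀ r j → j ≢ suc i → Q (suc i) r j ≈ Q (inject₁ i) r j
      off r j j≢i+1 = reflexive (agree (j ≤? inject₁ i))
        where
        agree : Dec (j ≤ inject₁ i) → Q (suc i) r j ≡ Q (inject₁ i) r j
        agree (yes j≤i) = ≡.trans (prefixSumColumns-≤ r (i≤inject₁[j]⇒i≤1+j j≤i))
                                  (≡.sym (prefixSumColumns-≤ r j≤i))
        agree (no j≰i)  = ≡.trans (prefixSumColumns-≰ r j≰i+1) (≡.sym (prefixSumColumns-≰ r j≰i))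
          where
          j≰i+1 : ¬ j ≤ suc i
          j≰i+1 j≤i+1 = j≰i (<⇒≤pred (≤∧≢⇒< j≤i+1 j≢i+1))
      column : ∀ r →
        Q (suc i) r (suc i) ≈ Q (inject₁ i) r (inject₁ i) + x (suc i) * Q (inject₁ i) r (suc i)
      column r = begin
        Q (suc i) r (suc i)                                ≡⟨ prefixSumColumns-≤ r (≤-refl {x = suc i}) ⟩
        partialSum S (suc i)                               ≈⟨ partialSum-suc S i ⟩
        partialSum S (inject₁ i) + x (suc i) * M r (suc i) ≡⟨ ≡.cong₂ (λ u v → u + x (suc i) * v) swept unswept ⟨
        Q (inject₁ i) r (inject₁ i) + x (suc i) * Q (inject₁ i) r (suc i) ∎
        where
        S = λ j → x j * M r j
        swept = prefixSumColumns-≤ r (≤-refl {x = inject₁ i})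
        unswept = prefixSumColumns-≰ r (ℕ.<⇒≱ (≤̄⇒inject₁< (≤-refl {x = i})))

  det≈0-of-kernel : ∀ {k} (M : Matrix k) (x : Fin k → Carrier) → Fin k →
    (∀ i → NonZeroDivisor (x i)) → (∀ r → sum (λ i → x i * M r i) ≈ 0#) →
    det k M ≈ 0#
  det≈0-of-kernel {suc k} M x _ x-regular Mx≈0 =
    <-weakInduction P base step (fromℕ k)
      (det-zeroColumn (prefixSumColumns M x (fromℕ k)) (fromℕ k) lastColumn≈0)
    where
    P : Fin (suc k) → Set ℓ₂
    P c = det (suc k) (prefixSumColumns M x c) ≈ 0# → det (suc k) M ≈ 0#

    base : P zero
    base Q₀≈0 = x-regular zero (trans (sym (det-prefixSumColumns-zero M x)) Q₀≈0)

    step : ∀ i → P (inject₁ i) → P (suc i)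
    step i P[i] Qᵢ₊₁≈0 = P[i] (x-regular (suc i) (trans (sym (det-prefixSumColumns-suc M x i)) Qᵢ₊₁≈0))

    lastColumn≈0 : ∀ r → prefixSumColumns M x (fromℕ k) r (fromℕ k) ≈ 0#
    lastColumn≈0 r = begin
      prefixSumColumns M x (fromℕ k) r (fromℕ k)  ≡⟨ prefixSumColumns-≤ M x r (≤-refl {x = fromℕ k}) ⟩
      partialSum (λ i → x i * M r i) (fromℕ k)    ≈⟨ partialSum-fromℕ k _ ⟩
      sum (λ i → x i * M r i)                     ≈⟨ Mx≈0 r ⟩
      0#                                          ∎

module GainGraph {n : ℕ} (G : SimpleGraph n) {a ℓ : Level} (M : Monoid a ℓ)
  (gain : ∀ {u v} → SimpleGraph.Adj G u v → Monoid.Carrier M)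
  (gain-inverse : ∀ {u v} (e : SimpleGraph.Adj G u v) (e′ : SimpleGraph.Adj G v u) →
    Monoid._≈_ M (Monoid._∙_ M (gain e) (gain e′)) (Monoid.ε M)) where

  open Monoid M
  open SimpleGraph G renaming (sym to Adj-sym)
  open GraphNotions G
  open import Relation.Binary.Reasoning.Setoid setoid

  walkGain : ∀ {u v} → Walk u v → Carrier
  walkGain []      = ε
  walkGain (e ∷ w) = gain e ∙ walkGain w

  _++ʷ_ : ∀ {u v w} → Walk u v → Walk v w → Walk u w
  []      ++ʷ q = q
  (e ∷ p) ++ʷ q = e ∷ (p ++ʷ q)

  reverseʷ : ∀ {u v} → Walk u v → Walk v u
  reverseʷ []      = []
  reverseʷ (e ∷ p) = reverseʷ p ++ʷ (Adj-sym e ∷ [])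

  walkGain-++ : ∀ {u v w} (p : Walk u v) (q : Walk v w) →
    walkGain (p ++ʷ q) ≈ walkGain p ∙ walkGain q
  walkGain-++ []      q = sym (identityˡ _)
  walkGain-++ (e ∷ p) q = trans (∙-congˡ (walkGain-++ p q)) (sym (assoc _ _ _))

  walkGain-reverse : ∀ {u v} (p : Walk u v) → walkGain (reverseʷ p) ∙ walkGain p ≈ ε
  walkGain-reverse []      = identityˡ ε
  walkGain-reverse (e ∷ p) = begin
    walkGain (reverseʷ p ++ʷ (Adj-sym e ∷ [])) ∙ (gain e ∙ walkGain p)
      ≈⟨ ∙-congʳ (trans (walkGain-++ (reverseʷ p) _) (∙-congˡ (identityʳ _))) ⟩
    (walkGain (reverseʷ p) ∙ gain (Adj-sym e)) ∙ (gain e ∙ walkGain p)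
      ≈⟨ assoc _ _ _ ⟩
    walkGain (reverseʷ p) ∙ (gain (Adj-sym e) ∙ (gain e ∙ walkGain p))
      ≈⟨ ∙-congˡ (sym (assoc _ _ _)) ⟩
    walkGain (reverseʷ p) ∙ ((gain (Adj-sym e) ∙ gain e) ∙ walkGain p)
      ≈⟨ ∙-congˡ (trans (∙-congʳ (gain-inverse (Adj-sym e) e)) (identityˡ _)) ⟩
    walkGain (reverseʷ p) ∙ walkGain p
      ≈⟨ walkGain-reverse p ⟩
    ε ∎

  module SimplePaths (acyclic : Acyclic) (r : Fin n) where

    data Path : ℕ → Fin n → Set where
      []  : Path 0 r
      _▷_ : ∀ {m u v} → Path m u → Adj u v → Path (suc m) v

    vertex : ∀ {m v} → Path m v → Fin (suc m) → Fin n
    vertex {v = v} _ zero    = v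
    vertex (p ▷ _) (suc i) = vertex p i

    vertex-fromℕ : ∀ {m v} (p : Path m v) → vertex p (fromℕ m) ≡ r
    vertex-fromℕ []      = ≡.refl
    vertex-fromℕ (p ▷ _) = vertex-fromℕ p

    vertex-adjacent : ∀ {m v} (p : Path m v) (i : Fin m) →
      Adj (vertex p (suc i)) (vertex p (inject₁ i))
    vertex-adjacent (p ▷ e) zero    = e
    vertex-adjacent (p ▷ _) (suc i) = vertex-adjacent p i

    pathGain : ∀ {m v} → Path m v → Carrier
    pathGain []      = ε
    pathGain (p ▷ e) = pathGain p ∙ gain e

    IsSimple : ∀ {m v} → Path m v → Set
    IsSimple p = Injective _≡_ _≡_ (vertex p)

    record SimplePathOfGain (v : Fin n) (g : Carrier) : Set ℓ where
      constructor simplePath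
      field
        {length} : ℕ
        path     : Path length v
        simple   : IsSimple path
        gain≈    : pathGain path ≈ g

    reweigh : ∀ {v g h} → g ≈ h → SimplePathOfGain v g → SimplePathOfGain v h
    reweigh g≈h (simplePath p simple gain≈) = simplePath p simple (trans gain≈ g≈h)

    cycle : ∀ {m u v} (p : Path (suc m) u) → IsSimple p → Adj u v →
            (k : Fin m) → vertex p (suc (suc k)) ≡ v → Cycle
    cycle {m} {u} p simple e k p[k+2]≡v = record
      { len = toℕ k ; vtx = vtx ; inj = inj ; step = step ; close = close }
      where
      k+3≤m+2 : suc (suc (suc (toℕ k))) ℕ.≤ suc (suc m)
      k+3≤m+2 = ℕ.s≤s (ℕ.s≤s (toℕ<n k))
      k+2≤m+1 = ℕ.s≤s⁻¹ k+3≤m+2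
      vtx : Fin (suc (suc (suc (toℕ k)))) → Fin n
      vtx i = vertex p (inject≤ i k+3≤m+2)
      inj : Injective _≡_ _≡_ vtx
      inj {i} {j} eq = inject≤-injective _ _ i j (simple eq)
      step : ∀ i → Adj (vtx (inject₁ i)) (vtx (suc i))
      step i = ≡.subst (λ t → Adj (vertex p t) (vtx (suc i))) (inject₁-inject≤ i k+2≤m+1)
                       (Adj-sym (vertex-adjacent p (inject≤ i k+2≤m+1)))
      last≡k : inject≤ (fromℕ (toℕ k)) (ℕ.s≤s⁻¹ k+2≤m+1) ≡ k
      last≡k = toℕ-injective (≡.trans (toℕ-inject≤ _ _) (toℕ-fromℕ _))
      close : Adj (vtx (fromℕ (suc (suc (toℕ k))))) (vtx zero)
      close = ≡.subst (λ t → Adj (vertex p (suc (suc t))) u) (≡.sym last≡k)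
                      (≡.subst (λ t → Adj t u) (≡.sym p[k+2]≡v) (Adj-sym e))

    ▷-simple : ∀ {m u v} (p : Path m u) (e : Adj u v) → IsSimple p →
               (∀ k → vertex p k ≢ v) → IsSimple (p ▷ e)
    ▷-simple p e simple v∉p {zero}  {zero}  _  = ≡.refl
    ▷-simple p e simple v∉p {zero}  {suc j} eq = ⊥-elim (v∉p j (≡.sym eq))
    ▷-simple p e simple v∉p {suc i} {zero}  eq = ⊥-elim (v∉p i eq)
    ▷-simple p e simple v∉p {suc i} {suc j} eq = ≡.cong suc (simple eq)

    -- An edge back into a simple path either returns to the previous vertex, where
    -- the two gains cancel, or closes a cycle.
    revisit : ∀ {m u v g} (p : Path m u) → IsSimple p → pathGain p ≈ g → (e : Adj u v) →
              (k : Fin (suc m)) → vertex p k ≡ v → SimplePathOfGain v (g ∙ gain e)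
    revisit p _ _ e zero ≡.refl = ⊥-elim (irrefl e)
    revisit {g = g} (q ▷ e₀) simple gain≈ e (suc zero) ≡.refl =
      simplePath q (λ {i} {j} eq → suc-injective (simple {suc i} {suc j} eq)) (begin
        pathGain q                       ≈⟨ identityʳ _ ⟨
        pathGain q ∙ ε                   ≈⟨ ∙-congˡ (gain-inverse e₀ e) ⟨
        pathGain q ∙ (gain e₀ ∙ gain e)  ≈⟨ assoc _ _ _ ⟨
        (pathGain q ∙ gain e₀) ∙ gain e  ≈⟨ ∙-congʳ gain≈ ⟩
        g ∙ gain e                       ∎)
    revisit p simple _ e (suc (suc k)) p[k+2]≡v =
      ⊥-elim (acyclic (cycle p simple e k p[k+2]≡v))

    extend : ∀ {u v g} → SimplePathOfGain u g → (e : Adj u v) → SimplePathOfGain v (g ∙ gain e)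
    extend {v = v} (simplePath p simple gain≈) e with any? (λ k → vertex p k ≟ v)
    ... | yes (k , p[k]≡v) = revisit p simple gain≈ e k p[k]≡v
    ... | no v∉p = simplePath (p ▷ e) (▷-simple p e simple (λ k p[k]≡v → v∉p (k , p[k]≡v)))
                                      (∙-congʳ gain≈)

    follow : ∀ {u v g} → SimplePathOfGain u g → (w : Walk u v) →
             SimplePathOfGain v (g ∙ walkGain w)
    follow sp []      = reweigh (sym (identityʳ _)) sp
    follow sp (e ∷ w) = reweigh (assoc _ _ _) (follow (extend sp e) w)

    simpleLoop-gain : ∀ {m} (p : Path m r) → IsSimple p → pathGain p ≈ ε
    simpleLoop-gain []          _      = refl
    simpleLoop-gain {suc m} p simple with simple {zero} {fromℕ (suc m)} (≡.sym (vertex-fromℕ p))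
    ... | ()

    emptyPath : SimplePathOfGain r ε
    emptyPath = simplePath [] (λ { {zero} {zero} _ → ≡.refl }) refl

    closedWalk-gain : (w : Walk r r) → walkGain w ≈ ε
    closedWalk-gain w = begin
      walkGain w      ≈⟨ identityˡ _ ⟨
      ε ∙ walkGain w  ≈⟨ gain≈ ⟨
      pathGain path   ≈⟨ simpleLoop-gain path simple ⟩
      ε               ∎
      where
      open SimplePathOfGain (follow emptyPath w)

  acyclic⇒walkGain-unique : Acyclic → ∀ {u v} (p q : Walk u v) → walkGain p ≈ walkGain q
  acyclic⇒walkGain-unique acyclic {u} p q = begin
    walkGain p                                         ≈⟨ identityʳ _ ⟨
    walkGain p ∙ ε                                     ≈⟨ ∙-congˡ (walkGain-reverse q) ⟨
    walkGain p ∙ (walkGain (reverseʷ q) ∙ walkGain q)  ≈⟨ assoc _ _ _ ⟨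
    (walkGain p ∙ walkGain (reverseʷ q)) ∙ walkGain q  ≈⟨ ∙-congʳ (walkGain-++ p (reverseʷ q)) ⟨
    walkGain (p ++ʷ reverseʷ q) ∙ walkGain q           ≈⟨ ∙-congʳ loop≈ε ⟩
    ε ∙ walkGain q                                     ≈⟨ identityˡ _ ⟩
    walkGain q                                         ∎
    where
    loop≈ε = SimplePaths.closedWalk-gain acyclic u (p ++ʷ reverseʷ q)

module LaplacianKernel {c ℓ c′ ℓ′ : Level} {F : CommutativeRing c ℓ} {K : CommutativeRing c′ ℓ′}
    (ι : RingHom F K) {n : ℕ} (G : SimpleGraph n)
    (φ : Fin n → Fin n → CommutativeRing.Carrier F)
    (s : Fin n → Fin n → CommutativeRing.Carrier K) where

  open CommutativeRing K hiding (zero)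
  open RingNotions K using (Σ[_])
  open SimpleGraph G using (Adj; adj?)
  open Laplacian ι G φ s
  open Determinant K using (Σ≡sum; sum-single; sum-linear)
  open import Algebra.Properties.Semiring.Sum semiring using (sum; sum-cong-≋; *-distribˡ-sum)
  open import Algebra.Properties.Ring ring using (-‿distribʳ-*; -1*x≈-x)
  open import Relation.Binary.Reasoning.Setoid setoid

  degreeTerm : Fin n → Fin n → Carrier
  degreeTerm r k = if ⌊ adj? r k ⌋ then s r k else 0#

  degMatrix-diagonal : ∀ r → degMatrix r r ≡ Σ[ n ] (degreeTerm r)
  degMatrix-diagonal r with r ≟ r
  ... | yes _   = ≡.refl
  ... | no r≢r = ⊥-elim (r≢r ≡.refl)

  degMatrix-offDiagonal : ∀ {r i} → i ≢ r → degMatrix r i ≡ 0#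
  degMatrix-offDiagonal {r} {i} i≢r with r ≟ i
  ... | yes r≡i = ⊥-elim (i≢r (≡.sym r≡i))
  ... | no _    = ≡.refl

  Lg-kernel : (x : Fin n → Carrier) →
    (∀ r j → Adj r j → x r * s r j ≈ x j * RingHom.map ι (φ r j)) →
    ∀ r → sum (λ i → x i * Lg r i) ≈ 0#
  Lg-kernel x balanced r = begin
    sum (λ i → x i * Lg r i)
      ≈⟨ sum-cong-≋ split ⟩
    sum (λ i → 1# * xD i + - 1# * xA i)
      ≈⟨ sum-linear 1# (- 1#) xD xA ⟩
    1# * sum xD + - 1# * sum xA
      ≈⟨ +-cong (*-identityˡ _) (-1*x≈-x _) ⟩
    sum xD - sum xA
      ≈⟨ +-congʳ degreeSum≈adjacencySum ⟩
    sum xA - sum xA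
      ≈⟨ -‿inverseʳ _ ⟩
    0# ∎
    where
    xD xA : Fin n → Carrier
    xD i = x i * degMatrix r i
    xA i = x i * adjMatrix r i

    split : ∀ i → x i * Lg r i ≈ 1# * xD i + - 1# * xA i
    split i = trans (distribˡ _ _ _)
      (+-cong (sym (*-identityˡ _)) (trans (sym (-‿distribʳ-* _ _)) (sym (-1*x≈-x _))))

    edgeTerm : ∀ k → x r * degreeTerm r k ≈ xA k
    edgeTerm k with adj? r k
    ... | yes r~k = balanced r k r~k
    ... | no _    = trans (zeroʳ _) (sym (zeroʳ _))

    offDiagonal≈0 : ∀ i → i ≢ r → xD i ≈ 0#
    offDiagonal≈0 i i≢r = trans (reflexive (≡.cong (x i *_) (degMatrix-offDiagonal i≢r))) (zeroʳ _)

    degreeSum≈adjacencySum : sum xD ≈ sum xA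
    degreeSum≈adjacencySum = begin
      sum xD                             ≈⟨ sum-single xD r offDiagonal≈0 ⟩
      x r * degMatrix r r                ≡⟨ ≡.cong (x r *_) (≡.trans (degMatrix-diagonal r) (Σ≡sum n _)) ⟩
      x r * sum (degreeTerm r)           ≈⟨ *-distribˡ-sum (x r) (degreeTerm r) ⟩
      sum (λ k → x r * degreeTerm r k)   ≈⟨ sum-cong-≋ edgeTerm ⟩
      sum xA                             ∎

module TreeLaplacian {c ℓ c′ ℓ′ : Level} {F : CommutativeRing c ℓ} {K : CommutativeRing c′ ℓ′}
    (fieldF : RingNotions.IsField F) (ι : RingHom F K)
    (f : CommutativeRing.Carrier F → CommutativeRing.Carrier F)
    (f-nonzero : ∀ x → ¬ CommutativeRing._≈_ F x (CommutativeRing.0# F) →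
      ¬ CommutativeRing._≈_ F (f x) (CommutativeRing.0# F))
    {n : ℕ} (G : SimpleGraph n)
    (φ : Fin n → Fin n → CommutativeRing.Carrier F)
    (φ-nonzero : ∀ i j → SimpleGraph.Adj G i j →
      ¬ CommutativeRing._≈_ F (φ i j) (CommutativeRing.0# F))
    (φ-skew : ∀ i j → SimpleGraph.Adj G i j → CommutativeRing._≈_ F (φ j i) (f (φ i j)))
    (s : Fin n → Fin n → CommutativeRing.Carrier K)
    (s-sym : ∀ i j → SimpleGraph.Adj G i j → CommutativeRing._≈_ K (s i j) (s j i))
    (s-square : ∀ i j → SimpleGraph.Adj G i j →
      CommutativeRing._≈_ K (CommutativeRing._*_ K (s i j) (s i j))
        (RingHom.map ι (CommutativeRing._*_ F (φ i j) (f (φ i j))))) where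

  module F = CommutativeRing F
  open CommutativeRing K hiding (zero)
  open SimpleGraph G using (Adj) renaming (sym to Adj-sym)
  open GraphNotions G using (Walk; []; _∷_; IsTree)
  open RingHom ι renaming (map to ι⟨_⟩)
  open Units K using (Unit; unit-*ˡ; unit-respects-≈; unit⇒nonZeroDivisor)
  open Laplacian ι G φ s using (Lg)
  open import Algebra.Solver.Ring.NaturalCoefficients.Default commutativeSemiring
    using (solve; _:=_; _:*_)
  open import Relation.Binary.Reasoning.Setoid setoid

  s-unit : ∀ {u v} → Adj u v → Unit (s u v)
  s-unit {u} {v} e = unit-*ˡ (unit-respects-≈ (sym (s-square u v e))
    (RingHom-unit ι (Units.unit-* F (nonzero⇒unit (φ-nonzero u v e))
                                    (nonzero⇒unit (f-nonzero _ (φ-nonzero u v e))))))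
    where
    nonzero⇒unit : ∀ {a} → ¬ a F.≈ F.0# → Units.Unit F a
    nonzero⇒unit = proj₂ fieldF _

  s⁻¹ : ∀ {u v} → Adj u v → Carrier
  s⁻¹ e = proj₁ (s-unit e)

  gain : ∀ {u v} → Adj u v → Carrier
  gain {u} {v} e = ι⟨ φ v u ⟩ * s⁻¹ (Adj-sym e)

  gain-inverse : ∀ {u v} (e : Adj u v) (e′ : Adj v u) → gain e * gain e′ ≈ 1#
  gain-inverse {u} {v} e e′ = begin
    (ι⟨ φ v u ⟩ * t) * (ι⟨ φ u v ⟩ * t′)
      ≈⟨ solve 4 (λ a t b t′ → (a :* t) :* (b :* t′) := (b :* a) :* (t :* t′)) refl _ t _ t′ ⟩
    (ι⟨ φ u v ⟩ * ι⟨ φ v u ⟩) * (t * t′)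
      ≈⟨ *-congʳ φφ≈ss ⟩
    (s v u * s u v) * (t * t′)
      ≈⟨ solve 4 (λ a b t t′ → (a :* b) :* (t :* t′) := (a :* t) :* (b :* t′)) refl _ _ t t′ ⟩
    (s v u * t) * (s u v * t′)
      ≈⟨ *-cong (proj₂ (s-unit (Adj-sym e))) (proj₂ (s-unit (Adj-sym e′))) ⟩
    1# * 1#
      ≈⟨ *-identityˡ 1# ⟩
    1# ∎
    where
    t  = s⁻¹ (Adj-sym e)
    t′ = s⁻¹ (Adj-sym e′)
    φφ≈ss : ι⟨ φ u v ⟩ * ι⟨ φ v u ⟩ ≈ s v u * s u v
    φφ≈ss = begin
      ι⟨ φ u v ⟩ * ι⟨ φ v u ⟩      ≈⟨ *-congˡ (cong (φ-skew u v e)) ⟩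
      ι⟨ φ u v ⟩ * ι⟨ f (φ u v) ⟩  ≈⟨ map-* _ _ ⟨
      ι⟨ φ u v F.* f (φ u v) ⟩     ≈⟨ s-square u v e ⟨
      s u v * s u v                ≈⟨ *-congʳ (s-sym u v e) ⟩
      s v u * s u v                ∎

  open GainGraph G *-monoid gain gain-inverse
    using (walkGain; _++ʷ_; reverseʷ; walkGain-++; walkGain-reverse; acyclic⇒walkGain-unique)

  walkGain-unit : ∀ {u v} (w : Walk u v) → Unit (walkGain w)
  walkGain-unit w = walkGain (reverseʷ w) , trans (*-comm _ _) (walkGain-reverse w)

  Lg-singular : IsTree → RingNotions.det K n Lg ≈ 0#
  Lg-singular (z , connected , acyclic) =
    Determinant.det≈0-of-kernel K Lg x z
      (λ v → unit⇒nonZeroDivisor (walkGain-unit (connected z v)))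
      (LaplacianKernel.Lg-kernel ι G φ s x balanced)
    where
    x : Fin n → Carrier
    x v = walkGain (connected z v)

    balanced : ∀ r j → Adj r j → x r * s r j ≈ x j * ι⟨ φ r j ⟩
    balanced r j e = begin
      x r * s r j
        ≈⟨ *-congʳ (acyclic⇒walkGain-unique acyclic (connected z r) viaJ) ⟩
      walkGain viaJ * s r j
        ≈⟨ *-congʳ (trans (walkGain-++ (connected z j) _) (*-congˡ (*-identityʳ _))) ⟩
      (x j * (ι⟨ φ r j ⟩ * t)) * s r j
        ≈⟨ solve 4 (λ a b t u → (a :* (b :* t)) :* u := (a :* b) :* (u :* t)) refl (x j) _ t (s r j) ⟩
      (x j * ι⟨ φ r j ⟩) * (s r j * t)
        ≈⟨ *-congˡ (proj₂ (s-unit (Adj-sym (Adj-sym e)))) ⟩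
      (x j * ι⟨ φ r j ⟩) * 1#
        ≈⟨ *-identityʳ _ ⟩
      x j * ι⟨ φ r j ⟩ ∎
      where
      t = s⁻¹ (Adj-sym (Adj-sym e))
      viaJ = connected z j ++ʷ (Adj-sym e ∷ [])

mainTheorem10 : ∀ {c ℓ c' ℓ' : Level} (F : CommutativeRing c ℓ) (K : CommutativeRing c' ℓ') →
  RingNotions.IsField F → RingNotions.CharZero F →
  RingNotions.IsField K → RingNotions.AlgClosed K →
  (ι : RingHom F K) →
  (f : CommutativeRing.Carrier F → CommutativeRing.Carrier F) →
  (∀ {x y} → CommutativeRing._≈_ F x y → CommutativeRing._≈_ F (f x) (f y)) →
  (∀ x → ¬ CommutativeRing._≈_ F x (CommutativeRing.0# F) →
    ¬ CommutativeRing._≈_ F (f x) (CommutativeRing.0# F)) →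
  (∀ x y → ¬ CommutativeRing._≈_ F x (CommutativeRing.0# F) →
    ¬ CommutativeRing._≈_ F y (CommutativeRing.0# F) →
    CommutativeRing._≈_ F (f (CommutativeRing._*_ F x y)) (CommutativeRing._*_ F (f x) (f y))) →
  (∀ x → ¬ CommutativeRing._≈_ F x (CommutativeRing.0# F) →
    CommutativeRing._≈_ F (f (f x)) x) →
  (n : ℕ) (G : SimpleGraph n) → GraphNotions.IsTree G →
  (φ : Fin n → Fin n → CommutativeRing.Carrier F) →
  (∀ i j → SimpleGraph.Adj G i j →
    ¬ CommutativeRing._≈_ F (φ i j) (CommutativeRing.0# F)) →
  (∀ i j → SimpleGraph.Adj G i j → CommutativeRing._≈_ F (φ j i) (f (φ i j))) →
  (s : Fin n → Fin n → CommutativeRing.Carrier K) →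
  (∀ i j → SimpleGraph.Adj G i j → CommutativeRing._≈_ K (s i j) (s j i)) →
  (∀ i j → SimpleGraph.Adj G i j →
    CommutativeRing._≈_ K (CommutativeRing._*_ K (s i j) (s i j))
      (RingHom.map ι (CommutativeRing._*_ F (φ i j) (f (φ i j))))) →
  CommutativeRing._≈_ K (RingNotions.det K n (Laplacian.Lg ι G φ s)) (CommutativeRing.0# K)
mainTheorem10 F K fieldF _ _ _ ι f _ f-nonzero _ _ n G tree φ φ-nonzero φ-skew s s-sym s-square =
  TreeLaplacian.Lg-singular fieldF ι f f-nonzero G φ φ-nonzero φ-skew s s-sym s-square tree
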